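{- Let $p$ be a prime, let $1 \leq m < n$, and let $V$ be a subspace of $\mathbb{Z}_p^n$ of codimension $m$, so that $V$ is the kernel of some $m \times n$ matrix $M$ over $\mathbb{Z}_p$ with columns $a_1,\dots,a_n\in\mathbb{Z}_p^m$. Let $A = \{a_1,\dots,a_n\} \subseteq \mathbb{Z}_p^m$. Then $h_p^c(A) \leq h_p(V)$. Moreover, if $h_p^c(A) < p$, then $h_p^c(A) = h_p(V)$.
   Context: For $v=(\bar b_1,\dots,\bar b_n)\in\mathbb{Z}_p^n$ with $0\le b_i<p$ the least nonnegative representatives, $h_p(v)=b_1+\dots+b_n$; for a nonzero subspace $V$, $h_p(V)=\min\{h_p(v):v\in V\setminus\{0\}\}$. For a nonempty $A\subseteq\mathbb{Z}_p^m$ and positive integer $k$, $kA=\{x_1+\dots+x_k:x_i\in A\}$, and the coheight $h_p^c(A)$ is the least positive integer $k$ such that $0\in kA$. -}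

module Defs where

open import Data.Nat using (ℕ; zero; suc; _+_; _*_; _≤_; _<_)
open import Data.Nat.Divisibility using (_∣_)
open import Data.Fin using (Fin; toℕ)
import Data.Fin as F
open import Data.Product using (Σ; _×_)
open import Relation.Binary.PropositionalEquality using (_≡_)
open import Relation.Nullary using (¬_)

∑ : ∀ {n} → (Fin n → ℕ) → ℕ
∑ {zero}  f = 0
∑ {suc n} f = f F.zero + ∑ (λ j → f (F.suc j))

-- Elements of ℤ_p are represented by Fin p; toℕ gives the least
-- nonnegative representative.  Vectors in ℤ_p^n : Fin n → Fin p.
-- An m × n matrix over ℤ_p : Fin m → Fin n → Fin p  (M i j = entry in row i, column j).
Mat : ℕ → ℕ → ℕ → Set
Mat p m n = Fin m → Fin n → Fin p

IsZeroVec : ∀ {p n} → (Fin n → Fin p) → Set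
IsZeroVec {n = n} v = ∀ (j : Fin n) → toℕ (v j) ≡ 0

hp : ∀ {p n} → (Fin n → Fin p) → ℕ
hp v = ∑ (λ j → toℕ (v j))

InKer : ∀ {p m n} → Mat p m n → (Fin n → Fin p) → Set
InKer {p} {m} M v = ∀ (i : Fin m) → p ∣ ∑ (λ j → toℕ (M i j) * toℕ (v j))

-- The rows of M are linearly independent over ℤ_p (rank M = m),
-- i.e. ker M has codimension m in ℤ_p^n.
FullRowRank : ∀ {p m n} → Mat p m n → Set
FullRowRank {p} {m} {n} M =
  ∀ (c : Fin m → Fin p) →
    (∀ (j : Fin n) → p ∣ ∑ (λ i → toℕ (c i) * toℕ (M i j))) → IsZeroVec c

IsHeight : ∀ {p m n} → Mat p m n → ℕ → Set
IsHeight {p} {m} {n} M h =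
  Σ (Fin n → Fin p) (λ v → InKer M v × ¬ IsZeroVec v × hp v ≡ h)
  × (∀ (v : Fin n → Fin p) → InKer M v → ¬ IsZeroVec v → h ≤ hp v)

-- A = {a_1,…,a_n} is the set of columns of M.  0 ∈ kA: there are
-- x_1,…,x_k ∈ A (each x_t = a_{f t}) with x_1 + … + x_k = 0 in ℤ_p^m.
ZeroInSumset : ∀ {p m n} → Mat p m n → ℕ → Set
ZeroInSumset {p} {m} {n} M k =
  Σ (Fin k → Fin n) (λ f → ∀ (i : Fin m) → p ∣ ∑ (λ t → toℕ (M i (f t))))

IsCoheight : ∀ {p m n} → Mat p m n → ℕ → Set
IsCoheight M c =
  1 ≤ c × ZeroInSumset M c × (∀ k → 1 ≤ k → k < c → ¬ ZeroInSumset M k)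

module Submission where

-- The theorem compares two ways of encoding "a multiset of columns of M
-- summing to zero".  A vector v ∈ ker M with entries b_j is the same thing
-- as the multiset taking column a_j exactly b_j times; its size is h_p(v).
-- Conversely a list of k columns a_{f 1}, …, a_{f k} summing to zero yields
-- the vector of multiplicities u_j = #{t | f t = j}, which lies in ker M
-- and has h_p(u) = k -- provided every multiplicity is a genuine residue,
-- which is guaranteed when k < p.

open import Defs
open import Data.Nat using (ℕ; zero; suc; _+_; _*_; _≤_; _<_; z≤n; s≤s)
open import Data.Nat.Properties
open import Data.Nat.Primality using (Prime)
open import Data.Nat.Divisibility using (_∣_)
open import Data.Fin using (Fin; toℕ; fromℕ<)
import Data.Fin as F
open import Data.Fin.Properties using (toℕ-fromℕ<)
open import Data.Vec.Functional using (Vector)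
open import Data.Product using (Σ; _×_; _,_)
open import Function using (_∘_)
open import Relation.Binary.PropositionalEquality
  using (_≡_; refl; sym; trans; cong; cong₂; subst; module ≡-Reasoning)
open import Relation.Nullary using (¬_)
open import Algebra.Properties.CommutativeMonoid.Sum +-0-commutativeMonoid
  using (sum; sum-cong-≗; ∑-distrib-+)

∑≡sum : ∀ {n} (f : Vector ℕ n) → ∑ f ≡ sum f
∑≡sum {zero}  f = refl
∑≡sum {suc n} f = cong (f F.zero +_) (∑≡sum (f ∘ F.suc))

∑-cong : ∀ {n} {f g : Fin n → ℕ} → (∀ j → f j ≡ g j) → ∑ f ≡ ∑ g
∑-cong {f = f} {g} f≗g = trans (∑≡sum f) (trans (sum-cong-≗ f≗g) (sym (∑≡sum g)))

∑-+ : ∀ {n} (f g : Fin n → ℕ) → ∑ (λ j → f j + g j) ≡ ∑ f + ∑ g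
∑-+ f g = begin
  ∑ (λ j → f j + g j)      ≡⟨ ∑≡sum (λ j → f j + g j) ⟩
  sum (λ j → f j + g j)    ≡⟨ ∑-distrib-+ f g ⟩
  sum f + sum g            ≡⟨ sym (cong₂ _+_ (∑≡sum f) (∑≡sum g)) ⟩
  ∑ f + ∑ g                ∎
  where open ≡-Reasoning

∑-const : ∀ k c → ∑ {k} (λ _ → c) ≡ c * k
∑-const zero    c = sym (*-zeroʳ c)
∑-const (suc k) c = trans (cong (c +_) (∑-const k c)) (sym (*-suc c k))

∑-zero : ∀ {n} {f : Fin n → ℕ} → (∀ j → f j ≡ 0) → ∑ f ≡ 0
∑-zero {n} f≗0 = trans (∑-cong f≗0) (∑-const n 0)

∑-mono-≤ : ∀ {n} {f g : Fin n → ℕ} → (∀ j → f j ≤ g j) → ∑ f ≤ ∑ g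
∑-mono-≤ {zero}  f≤g = z≤n
∑-mono-≤ {suc n} f≤g = +-mono-≤ (f≤g F.zero) (∑-mono-≤ (f≤g ∘ F.suc))

∑≡0⇒zero : ∀ {n} (f : Fin n → ℕ) → ∑ f ≡ 0 → ∀ j → f j ≡ 0
∑≡0⇒zero f ∑f≡0 F.zero    = m+n≡0⇒m≡0 (f F.zero) ∑f≡0
∑≡0⇒zero f ∑f≡0 (F.suc j) = ∑≡0⇒zero (f ∘ F.suc) (m+n≡0⇒n≡0 (f F.zero) ∑f≡0) j

hp-pos : ∀ {p n} (v : Fin n → Fin p) → ¬ IsZeroVec v → 1 ≤ hp v
hp-pos v v≢0 = n≢0⇒n>0 (v≢0 ∘ ∑≡0⇒zero (toℕ ∘ v))

hp-zero : ∀ {p n} (v : Fin n → Fin p) → IsZeroVec v → hp v ≡ 0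
hp-zero v = ∑-zero

-- From multiplicities to a list: `expand w` lists each index j exactly w j
-- times, so summing g along it is the weighted sum ∑_j g j · w j.
append : ∀ {a b} {X : Set} → (Fin a → X) → (Fin b → X) → Fin (a + b) → X
append {zero}  xs ys = ys
append {suc a} xs ys F.zero    = xs F.zero
append {suc a} xs ys (F.suc i) = append (xs ∘ F.suc) ys i

∑-append : ∀ {a b} {X : Set} (g : X → ℕ) (xs : Fin a → X) (ys : Fin b → X) →
  ∑ (g ∘ append xs ys) ≡ ∑ (g ∘ xs) + ∑ (g ∘ ys)
∑-append {zero}  g xs ys = refl
∑-append {suc a} g xs ys =
  trans (cong (g (xs F.zero) +_) (∑-append g (xs ∘ F.suc) ys))
        (sym (+-assoc (g (xs F.zero)) _ _))

expand : ∀ {n} (w : Fin n → ℕ) → Fin (∑ w) → Fin n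
expand {zero}  w ()
expand {suc n} w = append {w F.zero} (λ _ → F.zero) (F.suc ∘ expand (w ∘ F.suc))

∑-expand : ∀ {n} (w g : Fin n → ℕ) → ∑ (g ∘ expand w) ≡ ∑ (λ j → g j * w j)
∑-expand {zero}  w g = refl
∑-expand {suc n} w g =
  trans (∑-append {w F.zero} g (λ _ → F.zero) (F.suc ∘ expand (w ∘ F.suc)))
        (cong₂ _+_ (∑-const (w F.zero) (g F.zero)) (∑-expand (w ∘ F.suc) (g ∘ F.suc)))

δ : ∀ {n} → Fin n → Fin n → ℕ
δ F.zero    F.zero    = 1
δ F.zero    (F.suc _) = 0
δ (F.suc _) F.zero    = 0
δ (F.suc a) (F.suc b) = δ a b

δ≤1 : ∀ {n} (a b : Fin n) → δ a b ≤ 1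
δ≤1 F.zero    F.zero    = ≤-refl
δ≤1 F.zero    (F.suc _) = z≤n
δ≤1 (F.suc _) F.zero    = z≤n
δ≤1 (F.suc a) (F.suc b) = δ≤1 a b

∑-δ : ∀ {n} (g : Fin n → ℕ) (a : Fin n) → ∑ (λ j → g j * δ a j) ≡ g a
∑-δ {suc n} g F.zero =
  trans (cong₂ _+_ (*-identityʳ (g F.zero)) (∑-zero (λ j → *-zeroʳ (g (F.suc j)))))
        (+-identityʳ (g F.zero))
∑-δ {suc n} g (F.suc a) =
  trans (cong (_+ ∑ (λ j → g (F.suc j) * δ a j)) (*-zeroʳ (g F.zero)))
        (∑-δ (g ∘ F.suc) a)

count : ∀ {k n} → (Fin k → Fin n) → Fin n → ℕ
count f j = ∑ (λ t → δ (f t) j)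

count≤length : ∀ {k n} (f : Fin k → Fin n) (j : Fin n) → count f j ≤ k
count≤length {k} f j =
  ≤-trans (∑-mono-≤ (λ t → δ≤1 (f t) j)) (≤-reflexive (trans (∑-const k 1) (*-identityˡ k)))

∑-count : ∀ {k n} (f : Fin k → Fin n) (g : Fin n → ℕ) →
  ∑ (g ∘ f) ≡ ∑ (λ j → g j * count f j)
∑-count {zero}  f g = sym (∑-zero (λ j → *-zeroʳ (g j)))
∑-count {suc k} f g = begin
  g (f F.zero) + ∑ (g ∘ f ∘ F.suc)
    ≡⟨ cong₂ _+_ (sym (∑-δ g (f F.zero))) (∑-count (f ∘ F.suc) g) ⟩
  ∑ (λ j → g j * δ (f F.zero) j) + ∑ (λ j → g j * count (f ∘ F.suc) j)
    ≡⟨ sym (∑-+ (λ j → g j * δ (f F.zero) j) (λ j → g j * count (f ∘ F.suc) j)) ⟩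
  ∑ (λ j → g j * δ (f F.zero) j + g j * count (f ∘ F.suc) j)
    ≡⟨ ∑-cong (λ j → sym (*-distribˡ-+ (g j) (δ (f F.zero) j) _)) ⟩
  ∑ (λ j → g j * count f j) ∎
  where open ≡-Reasoning

kernel⇒zeroSum : ∀ {p m n} (M : Mat p m n) (v : Fin n → Fin p) →
  InKer M v → ZeroInSumset M (hp v)
kernel⇒zeroSum {p} M v v∈ker =
  expand (toℕ ∘ v) ,
  λ i → subst (p ∣_) (sym (∑-expand (toℕ ∘ v) (toℕ ∘ M i))) (v∈ker i)

-- A zero-sum of k < p columns yields a kernel vector of height k: its
-- multiplicities are at most k, hence genuine residues mod p.
zeroSum⇒kernel : ∀ {p m n k} (M : Mat p m n) → ZeroInSumset M k → k < p →
  Σ (Fin n → Fin p) (λ u → InKer M u × hp u ≡ k)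
zeroSum⇒kernel {p} {k = k} M (f , f-zero) k<p = u , u∈ker , hp-u
  where
  count<p : ∀ j → count f j < p
  count<p j = ≤-<-trans (count≤length f j) k<p

  u : Fin _ → Fin p
  u j = fromℕ< (count<p j)

  u≗count : ∀ j → toℕ (u j) ≡ count f j
  u≗count j = toℕ-fromℕ< (count<p j)

  u∈ker : InKer M u
  u∈ker i = subst (p ∣_) (trans (∑-count f (toℕ ∘ M i))
                                (∑-cong (λ j → cong (toℕ (M i j) *_) (sym (u≗count j)))))
                  (f-zero i)

  hp-u : hp u ≡ k
  hp-u = begin
    ∑ (toℕ ∘ u)                    ≡⟨ ∑-cong (λ j → trans (u≗count j) (sym (*-identityˡ _))) ⟩
    ∑ (λ j → 1 * count f j)        ≡⟨ sym (∑-count f (λ _ → 1)) ⟩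
    ∑ {k} (λ _ → 1)                ≡⟨ trans (∑-const k 1) (*-identityˡ k) ⟩
    k                              ∎
    where open ≡-Reasoning

proposition1 : ∀ (p m n : ℕ) → Prime p → 1 ≤ m → m < n →
    (M : Mat p m n) → FullRowRank M →
    ∀ (c h : ℕ) → IsCoheight M c → IsHeight M h →
    c ≤ h × (c < p → c ≡ h)
proposition1 p m n _ _ _ M _ c h
  (1≤c , c-zeroSum , c-least) ((v , v∈ker , v≢0 , hp-v) , h-least) =
  c≤h , c≡h
  where
  -- v gives a zero-sum of positive size h, which cannot be below c.
  c≤h : c ≤ h
  c≤h = ≮⇒≥ (λ h<c → c-least h (subst (1 ≤_) hp-v (hp-pos v v≢0)) h<c
                        (subst (ZeroInSumset M) hp-v (kernel⇒zeroSum M v v∈ker)))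

  -- A zero-sum of size c < p gives a nonzero kernel vector of height c.
  c≡h : c < p → c ≡ h
  c≡h c<p with zeroSum⇒kernel M c-zeroSum c<p
  ... | u , u∈ker , hp-u = ≤-antisym c≤h (subst (h ≤_) hp-u (h-least u u∈ker u≢0))
    where
    u≢0 : ¬ IsZeroVec u
    u≢0 u≡0 = <⇒≢ 1≤c (sym (trans (sym hp-u) (hp-zero u u≡0)))
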